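{- Let $(A,\leq,{}',0,1)$ be a finite orthomodular poset, let $(T,R)$ be a time frame, and let $P,G\colon A^T\to(2^A\setminus\{\emptyset\})^T$ be the tense operators $P(q)(s)=\operatorname{Min}U(\{q(t)\mid t\mathrel Rs\})$ and $G(q)(s)=\operatorname{Max}L(\{q(t)\mid s\mathrel Rt\})$. Then the couple $(P,G)$ forms a dynamic pair, i.e. (P1) $G(1)=1$ and $P(0)=0$ (where $0,1$ denote the constant functions $T\to A$); (P2) if $p,q\in A^T$ and $p\leq q$ then $G(p)\leq_1G(q)$ and $P(p)\leq_2P(q)$; (P3) if $q\in A^T$ then $q\leq_1(G*P)(q)$ and $(P*G)(q)\leq_2q$.
   Context: An orthomodular poset is a bounded poset $(A,\leq,0,1)$ with a unary operation ${}'$ that is an antitone involution ($a\leq b\Rightarrow b'\leq a'$, $a''=a$) and a complementation ($a\vee a'=1$, $a\wedge a'=0$), such that (i) if $x\leq y'$ then $x\vee y=\sup(x,y)$ exists, and (ii) if $x\leq y$ then $y=x\vee(y\wedge x')$. For $B\subseteq A$: $L(B)=\{x\in A\mid x\leq b\text{ for all }b\in B\}$, $U(B)=\{x\in A\mid b\leq x\text{ for all }b\in B\}$; $\operatorname{Max}B$ and $\operatorname{Min}B$ are the sets of maximal and minimal elements of $B$. A time frame is a pair $(T,R)$ with $T\neq\emptyset$ and $R\subseteq T^2$ serial (for each $s\in T$ there are $r,t\in T$ with $r\mathrel Rs$ and $s\mathrel Rt$). The tense operators are extended to nonempty $B\subseteq A^T$ by $P(B)(s)=\operatorname{Min}U(\{q(t)\mid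 q\in B,\ t\mathrel Rs\})$ and $G(B)(s)=\operatorname{Max}L(\{q(t)\mid q\in B,\ s\mathrel Rt\})$ (a single $q\in A^T$ is identified with $\{q\}$). The transformation function $\varphi\colon(2^A\setminus\{\emptyset\})^T\to2^{(A^T)}\setminus\{\emptyset\}$ is $\varphi(x)=\{q\in A^T\mid q(t)\in x(t)\text{ for all }t\in T\}$, and $G*P:=G\circ\varphi\circ P$, $P*G:=P\circ\varphi\circ G$. For nonempty $B,C\subseteq A$: $B\leq_1C$ iff for every $b\in B$ there is $c\in C$ with $b\leq c$; $B\leq_2C$ iff for every $c\in C$ there is $b\in B$ with $b\leq c$. For $x,y\in(2^A\setminus\{\emptyset\})^T$, $x\leq_iy$ iff $x(t)\leq_iy(t)$ for all $t\in T$; elements $a\in A$ are identified with $\{a\}$ and $p\in A^T$ with $t\mapsto\{p(t)\}$; $p\leq q$ for $p,q\in A^T$ means $p(t)\leq q(t)$ for all $t$. -}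

module Defs where

open import Level using (0ℓ)
open import Data.Nat using (ℕ)
open import Data.Fin using (Fin)
open import Data.Product using (Σ; ∃; _×_; _,_)
open import Function.Bundles using (_↔_)
open import Relation.Binary.PropositionalEquality using (_≡_)
open import Relation.Binary.Structures using (IsPartialOrder)
open import Relation.Unary using (Pred; _≐_)

module Bounds {A : Set} (_≤_ : A → A → Set) where
  L : Pred A 0ℓ → Pred A 0ℓ
  L B x = ∀ b → B b → x ≤ b
  U : Pred A 0ℓ → Pred A 0ℓ
  U B x = ∀ b → B b → b ≤ x
  Max : Pred A 0ℓ → Pred A 0ℓ
  Max B x = B x × (∀ y → B y → x ≤ y → y ≡ x)
  Min : Pred A 0ℓ → Pred A 0ℓ
  Min B x = B x × (∀ y → B y → y ≤ x → y ≡ x)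
  IsSup : A → A → A → Set
  IsSup x y z = x ≤ z × y ≤ z × (∀ w → x ≤ w → y ≤ w → z ≤ w)
  IsInf : A → A → A → Set
  IsInf x y z = z ≤ x × z ≤ y × (∀ w → w ≤ x → w ≤ y → w ≤ z)

record OrthomodularPoset : Set₁ where
  field
    Carrier   : Set
    _≤_       : Carrier → Carrier → Set
    isPartialOrder : IsPartialOrder _≡_ _≤_
    𝟘 𝟙       : Carrier
    𝟘-least   : ∀ x → 𝟘 ≤ x
    𝟙-greatest : ∀ x → x ≤ 𝟙
    _′        : Carrier → Carrier
  open Bounds _≤_ public
  field
    antitone  : ∀ {a b} → a ≤ b → (b ′) ≤ (a ′)
    involutive : ∀ a → ((a ′) ′) ≡ a
    compl-sup : ∀ a → IsSup a (a ′) 𝟙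
    compl-inf : ∀ a → IsInf a (a ′) 𝟘
    orth-sup  : ∀ x y → x ≤ (y ′) → ∃ λ z → IsSup x y z
    orthomodular : ∀ x y → x ≤ y →
      ∃ λ m → IsInf y (x ′) m × IsSup x m y

Finite : Set → Set
Finite A = Σ ℕ λ n → A ↔ Fin n

record TimeFrame (T : Set) (R : T → T → Set) : Set where
  field
    inhabited : T
    serial-past   : ∀ s → ∃ λ r → R r s
    serial-future : ∀ s → ∃ λ t → R s t

module Tense (O : OrthomodularPoset) {T : Set} (R : T → T → Set) where
  open OrthomodularPoset O

  PB : Pred (T → Carrier) 0ℓ → T → Pred Carrier 0ℓ
  PB B s = Min (U (λ a → ∃ λ q → B q × ∃ λ t → R t s × q t ≡ a))
  GB : Pred (T → Carrier) 0ℓ → T → Pred Carrier 0ℓ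
  GB B s = Max (L (λ a → ∃ λ q → B q × ∃ λ t → R s t × q t ≡ a))

  ⟦_⟧ : (T → Carrier) → Pred (T → Carrier) 0ℓ
  ⟦ q ⟧ r = r ≡ q

  P : (T → Carrier) → T → Pred Carrier 0ℓ
  P q = PB ⟦ q ⟧
  G : (T → Carrier) → T → Pred Carrier 0ℓ
  G q = GB ⟦ q ⟧

  φ : (T → Pred Carrier 0ℓ) → Pred (T → Carrier) 0ℓ
  φ x q = ∀ t → x t (q t)

  G*P : (T → Carrier) → T → Pred Carrier 0ℓ
  G*P q = GB (φ (P q))
  P*G : (T → Carrier) → T → Pred Carrier 0ℓ
  P*G q = PB (φ (G q))

  _≤₁_ : Pred Carrier 0ℓ → Pred Carrier 0ℓ → Set
  B ≤₁ C = ∀ b → B b → ∃ λ c → C c × b ≤ c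
  _≤₂_ : Pred Carrier 0ℓ → Pred Carrier 0ℓ → Set
  B ≤₂ C = ∀ c → C c → ∃ λ b → B b × b ≤ c

  _≤₁ᵀ_ : (T → Pred Carrier 0ℓ) → (T → Pred Carrier 0ℓ) → Set
  x ≤₁ᵀ y = ∀ t → x t ≤₁ y t
  _≤₂ᵀ_ : (T → Pred Carrier 0ℓ) → (T → Pred Carrier 0ℓ) → Set
  x ≤₂ᵀ y = ∀ t → x t ≤₂ y t

  -- p ∈ A^T identified with t ↦ {p(t)}
  sing : (T → Carrier) → T → Pred Carrier 0ℓ
  sing p t a = a ≡ p t

  _≤ᵀ_ : (T → Carrier) → (T → Carrier) → Set
  p ≤ᵀ q = ∀ t → p t ≤ q t

  const𝟘 const𝟙 : T → Carrier
  const𝟘 _ = 𝟘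
  const𝟙 _ = 𝟙

  DynamicPair : Set
  DynamicPair =
    ((∀ s → G const𝟙 s ≐ sing const𝟙 s) × (∀ s → P const𝟘 s ≐ sing const𝟘 s))
    × (∀ p q → p ≤ᵀ q → (G p ≤₁ᵀ G q) × (P p ≤₂ᵀ P q))
    × (∀ q → (sing q ≤₁ᵀ G*P q) × (P*G q ≤₂ᵀ sing q))

-- In a finite poset every element of a subset B lies below a maximal element of B and
-- above a minimal one. Each clause of (P2) and (P3) is therefore reduced to an inclusion
-- between sets of bounds: for instance q(s) is a lower bound of the future values of
-- every r ∈ φ(P q), because whenever s R t, q(s) is a past value seen from t and r(t) is
-- an upper bound of those. (P1) holds because the only bounds of a constant 1 (resp. 0)
-- that are maximal (resp. minimal) are 1 (resp. 0) themselves.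
module Submission where

open import Defs
open import Level using (0ℓ)
open import Axiom.ExcludedMiddle using (ExcludedMiddle)
open import Data.Empty using (⊥-elim)
open import Data.List using (List; []; _∷_; map; allFin)
open import Data.List.Membership.Propositional using (_∈_)
open import Data.List.Membership.Propositional.Properties using (∈-map⁺; ∈-allFin)
open import Data.List.Relation.Unary.Any using (here; there)
open import Data.Product using (∃; _×_; _,_; proj₁; proj₂)
open import Function.Bundles using (Inverse)
open import Relation.Binary.PropositionalEquality using (_≡_; refl; sym; subst)
open import Relation.Binary.Structures using (IsPartialOrder)
import Relation.Binary.Construct.Flip.EqAndOrd as Flip
open import Relation.Nullary using (yes; no)
open import Relation.Unary using (Pred; _⊆_; _≐_)

finite-enumeration : ∀ {A : Set} → Finite A → ∃ λ (xs : List A) → ∀ x → x ∈ xs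
finite-enumeration (n , A↔Fin) =
  map from (allFin n) ,
  λ x → subst (_∈ map from (allFin n)) (strictlyInverseʳ x) (∈-map⁺ from (∈-allFin (to x)))
  where open Inverse A↔Fin

module MaximalElements {A : Set} {_⊑_ : A → A → Set} (po : IsPartialOrder _≡_ _⊑_) where
  open IsPartialOrder po using (reflexive; antisym; trans) renaming (refl to ⊑-refl)
  open Bounds _⊑_

  Max-L-of-greatest : ∀ {⊤} → (∀ x → x ⊑ ⊤) → (S : Pred A 0ℓ) → S ⊆ (_≡ ⊤) →
                      Max (L S) ≐ (_≡ ⊤)
  Max-L-of-greatest {⊤} greatest S S⊆⊤ =
    (λ { {x} (_ , maximal) → sym (maximal ⊤ ⊤-lower-bound (greatest x)) }) ,
    (λ { refl → ⊤-lower-bound , λ y _ ⊤⊑y → antisym (greatest y) ⊤⊑y })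
    where
    ⊤-lower-bound : L S ⊤
    ⊤-lower-bound _ b∈S = reflexive (sym (S⊆⊤ b∈S))

  module _ (em : ExcludedMiddle 0ℓ) (B : Pred A 0ℓ) where

    -- Scan xs, moving the candidate up to every later element of B above it.
    maximal-above-among : ∀ xs {b} → B b →
      ∃ λ c → B c × b ⊑ c × (∀ x → x ∈ xs → B x → c ⊑ x → x ≡ c)
    maximal-above-among [] {b} b∈B = b , b∈B , ⊑-refl , λ _ ()
    maximal-above-among (x ∷ xs) {b} b∈B with em {B x × b ⊑ x}
    ... | yes (x∈B , b⊑x) =
      let c , c∈B , x⊑c , maximal = maximal-above-among xs x∈B
      in c , c∈B , trans b⊑x x⊑c ,
         λ { _ (here refl) _ c⊑x → antisym x⊑c c⊑x
           ; y (there y∈xs) y∈B c⊑y → maximal y y∈xs y∈B c⊑y }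
    ... | no ¬x∈B×b⊑x =
      let c , c∈B , b⊑c , maximal = maximal-above-among xs b∈B
      in c , c∈B , b⊑c ,
         λ { _ (here refl) x∈B c⊑x → ⊥-elim (¬x∈B×b⊑x (x∈B , trans b⊑c c⊑x))
           ; y (there y∈xs) y∈B c⊑y → maximal y y∈xs y∈B c⊑y }

    maximal-above : ∀ {xs} → (∀ x → x ∈ xs) → ∀ {b} → B b → ∃ λ c → Max B c × b ⊑ c
    maximal-above {xs} complete b∈B =
      let c , c∈B , b⊑c , maximal = maximal-above-among xs b∈B
      in c , (c∈B , λ y y∈B c⊑y → maximal y (complete y) y∈B c⊑y) , b⊑c

module DynamicPairProperties (O : OrthomodularPoset) {T : Set} (R : T → T → Set) where
  open OrthomodularPoset O
  open Tense O R
  open IsPartialOrder isPartialOrder using (trans)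

  future past : Pred (T → Carrier) 0ℓ → T → Pred Carrier 0ℓ
  future B s a = ∃ λ q → B q × ∃ λ t → R s t × q t ≡ a
  past   B s a = ∃ λ q → B q × ∃ λ t → R t s × q t ≡ a

  G-const𝟙 : ∀ s → G const𝟙 s ≐ sing const𝟙 s
  G-const𝟙 s = MaximalElements.Max-L-of-greatest isPartialOrder 𝟙-greatest
                 (future ⟦ const𝟙 ⟧ s) λ { (_ , refl , _ , _ , refl) → refl }

  P-const𝟘 : ∀ s → P const𝟘 s ≐ sing const𝟘 s
  P-const𝟘 s = MaximalElements.Max-L-of-greatest (Flip.isPartialOrder isPartialOrder) 𝟘-least
                 (past ⟦ const𝟘 ⟧ s) λ { (_ , refl , _ , _ , refl) → refl }

  L-future-mono : ∀ {p q} → p ≤ᵀ q → ∀ s → L (future ⟦ p ⟧ s) ⊆ L (future ⟦ q ⟧ s)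
  L-future-mono {p} p≤q s x-lower _ (_ , refl , t , sRt , refl) =
    trans (x-lower (p t) (p , refl , t , sRt , refl)) (p≤q t)

  U-past-antimono : ∀ {p q} → p ≤ᵀ q → ∀ s → U (past ⟦ q ⟧ s) ⊆ U (past ⟦ p ⟧ s)
  U-past-antimono {q = q} p≤q s x-upper _ (_ , refl , t , tRs , refl) =
    trans (p≤q t) (x-upper (q t) (q , refl , t , tRs , refl))

  present-below-future-of-P : ∀ q s → L (future (φ (P q)) s) (q s)
  present-below-future-of-P q s _ (_ , r∈φPq , t , sRt , refl) =
    proj₁ (r∈φPq t) (q s) (q , refl , s , sRt , refl)

  present-above-past-of-G : ∀ q s → U (past (φ (G q)) s) (q s)
  present-above-past-of-G q s _ (_ , r∈φGq , t , tRs , refl) =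
    proj₁ (r∈φGq t) (q s) (q , refl , s , tRs , refl)

  module Finiteness (em : ExcludedMiddle 0ℓ) {xs : List Carrier} (complete : ∀ x → x ∈ xs) where

    ⊆-Max-≤₁ : ∀ {X Y} → X ⊆ Y → X ≤₁ Max Y
    ⊆-Max-≤₁ X⊆Y _ b∈X =
      MaximalElements.maximal-above isPartialOrder em _ complete (X⊆Y b∈X)

    ⊆-Min-≤₂ : ∀ {X Y} → Y ⊆ X → Min X ≤₂ Y
    ⊆-Min-≤₂ Y⊆X _ c∈Y =
      MaximalElements.maximal-above (Flip.isPartialOrder isPartialOrder) em _ complete (Y⊆X c∈Y)

    G-mono : ∀ p q → p ≤ᵀ q → G p ≤₁ᵀ G q
    G-mono p q p≤q s = ⊆-Max-≤₁ (λ b∈Gp → L-future-mono p≤q s (proj₁ b∈Gp))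

    P-mono : ∀ p q → p ≤ᵀ q → P p ≤₂ᵀ P q
    P-mono p q p≤q s = ⊆-Min-≤₂ (λ c∈Pq → U-past-antimono p≤q s (proj₁ c∈Pq))

    below-G*P : ∀ q → sing q ≤₁ᵀ G*P q
    below-G*P q s = ⊆-Max-≤₁ λ { refl → present-below-future-of-P q s }

    above-P*G : ∀ q → P*G q ≤₂ᵀ sing q
    above-P*G q s = ⊆-Min-≤₂ λ { refl → present-above-past-of-G q s }

theorem7 : ExcludedMiddle 0ℓ →
    (O : OrthomodularPoset) → Finite (OrthomodularPoset.Carrier O) →
    (T : Set) (R : T → T → Set) → TimeFrame T R →
    Tense.DynamicPair O R
theorem7 em O finite T R _ =
  (G-const𝟙 , P-const𝟘) ,
  (λ p q p≤q → G-mono p q p≤q , P-mono p q p≤q) ,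
  (λ q → below-G*P q , above-P*G q)
  where
  open DynamicPairProperties O R
  open Finiteness em (proj₂ (finite-enumeration finite))
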